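{- Let $\mathcal{G}=(V_\mathcal{G},E^+_\mathcal{G},E^-_\mathcal{G},L_\mathcal{G})$ be a signed graph with $V_\mathcal{G}=[n]$. If $\mathcal{G}$ has an odd full cyclic permutation ordering and $|E_\mathcal{G}|=n$, then $\bar{\mathcal{G}}$ is a tree and $|L_\mathcal{G}|=1$.
   Context: $[n]=\{1,\dots,n\}$, $I_n=\{ -n,\dots,-1,1,\dots,n\}$, $\mathfrak{H}_n=\{\eta\in\mathfrak{S}_{I_n}:\eta(-i)=-\eta(i)\ \forall i\in I_n\}$. For distinct $i,j\in[n]$: $(i\ j)$ swaps $i\leftrightarrow j$, $-i\leftrightarrow -j$; $(i\ { -j})$ sends $i\mapsto -j$, $j\mapsto -i$ (and correspondingly on negatives); for $i\in[n]$, $(i\ { -i})$ swaps $i\leftrightarrow -i$; each fixes everything else. $\eta\in\mathfrak{H}_n$ is an odd full cyclic permutation if there are an ordering $i_1,\dots,i_n$ of $[n]$ and signs $\epsilon_k\in\{\pm1\}$ with $\eta(i_k)=\epsilon_k i_{k+1}$ (indices mod $n$) and $\epsilon_1\cdots\epsilon_n=-1$. A signed graph is $\mathcal{G}=(V_\mathcal{G},E^+_\mathcal{G},E^-_\mathcal{G},L_\mathcal{G})$ with $V_\mathcal{G}=[n]$, $E^\pm_\mathcal{G}$ sets of 2-element subsets of $[n]$, $L_\mathcal{G}\subseteq[n]$ (loops); $E_\mathcal{G}=E^+_\mathcal{G}\sqcup E^-_\mathcal{G}\sqcup L_\mathcal{G}$ (loops count as edges). Set $\tau_e=(i\ j)$,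 $(i\ { -j})$, $(i\ { -i})$ for $e=\{i,j\}\in E^+_\mathcal{G}$, $e=\{i,j\}\in E^-_\mathcal{G}$, $e=i\in L_\mathcal{G}$ respectively. For an edge ordering (linear order) $\omega=(e_1,\dots,e_m)$ of $E_\mathcal{G}$, $\pi_\omega=\tau_{e_m}\cdots\tau_{e_1}$; $\omega$ is an odd full cyclic permutation ordering if $\pi_\omega$ is an odd full cyclic permutation. $\bar{\mathcal{G}}$ is the unsigned multigraph on $[n]$ with edge multiset $E^+_\mathcal{G}\sqcup E^-_\mathcal{G}$. -}

module Defs where

open import Data.Nat using (ℕ; zero; suc; _≤_)
open import Data.Nat.DivMod using (_mod_)
open import Data.Fin using (Fin; toℕ; _≟_) renaming (_<_ to _<ᶠ_)
open import Data.Bool using (Bool; true; false; _xor_; if_then_else_)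
open import Data.List using (List; []; _∷_; map; _++_; length; lookup; foldr; allFin)
open import Data.List.Relation.Unary.All using (All)
open import Data.List.Relation.Unary.Unique.Propositional using (Unique)
open import Data.List.Relation.Binary.Permutation.Propositional using (_↭_)
open import Data.Product using (_×_; _,_; Σ; ∃; proj₁; proj₂)
open import Data.Sum using (_⊎_)
open import Relation.Binary.PropositionalEquality using (_≡_)
open import Relation.Nullary using (¬_; does)
open import Function.Bundles using (_↔_; Inverse)
open import Function.Definitions using (Injective)

-- Elements of I_n are encoded as pairs (s , j) : Bool × Fin n, where
-- s = true means the negative element -j and s = false means +j
-- (Fin n = {0,…,n-1} stands for [n] = {1,…,n}).
-- An element η of the hyperoctahedral group 𝔥_n is determined by its
-- values on the positive elements (η(-i) = -η(i)), so we represent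
-- signed permutations by their restriction  Fin n → Bool × Fin n.

SPerm : ℕ → Set
SPerm n = Fin n → Bool × Fin n

idS : ∀ {n} → SPerm n
idS i = false , i

-- composition (η ∘ θ)(i) = η(θ(i)), using η(-j) = -η(j)
_∘S_ : ∀ {n} → SPerm n → SPerm n → SPerm n
(η ∘S θ) i with θ i
... | s , j with η j
...   | t , k = (s xor t) , k

next : ∀ {n} → Fin n → Fin n
next {suc n} k = suc (toℕ k) mod suc n

-- η is an odd full cyclic permutation: there are an ordering
-- i_1,…,i_n of [n] (a bijection ord : Fin n ↔ Fin n, ord k = i_k) and signs ε_k
-- with η(i_k) = ε_k i_{k+1} (indices mod n) and ε_1⋯ε_n = -1
-- (product of signs = xor of the "negative" flags being true).
OddFullCyclic : ∀ {n} → SPerm n → Set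
OddFullCyclic {n} η =
  Σ (Fin n ↔ Fin n) λ ord →
  Σ (Fin n → Bool) λ ε →
    ((k : Fin n) → η (Inverse.to ord k) ≡ (ε k , Inverse.to ord (next k)))
    × foldr _xor_ false (map ε (allFin n)) ≡ true

data Edge (n : ℕ) : Set where
  pos  : Fin n → Fin n → Edge n
  neg  : Fin n → Fin n → Edge n
  loop : Fin n → Edge n

-- a 2-element subset {i,j} is stored canonically as (i , j) with i < j
Canonical : ∀ {n} → Fin n × Fin n → Set
Canonical (i , j) = i <ᶠ j

record SignedGraph (n : ℕ) : Set where
  field
    E⁺ : List (Fin n × Fin n)
    E⁻ : List (Fin n × Fin n)
    L  : List (Fin n)
    E⁺-canonical : All Canonical E⁺
    E⁻-canonical : All Canonical E⁻
    E⁺-unique : Unique E⁺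
    E⁻-unique : Unique E⁻
    L-unique  : Unique L

  -- E_G = E⁺ ⊔ E⁻ ⊔ L (disjoint union, loops count as edges)
  edges : List (Edge n)
  edges = map (λ p → pos (proj₁ p) (proj₂ p)) E⁺
       ++ map (λ p → neg (proj₁ p) (proj₂ p)) E⁻
       ++ map loop L

  -- edge multiset of the unsigned multigraph Ḡ : E⁺ ⊔ E⁻
  barEdges : List (Fin n × Fin n)
  barEdges = E⁺ ++ E⁻

open SignedGraph public

τ : ∀ {n} → Edge n → SPerm n
τ (pos i j) x = if does (x ≟ i) then (false , j)
                else if does (x ≟ j) then (false , i) else (false , x)
τ (neg i j) x = if does (x ≟ i) then (true , j)
                else if does (x ≟ j) then (true , i) else (false , x)
τ (loop i) x = if does (x ≟ i) then (true , i) else (false , x)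

πω : ∀ {n} → List (Edge n) → SPerm n
πω [] = idS
πω (e ∷ es) = πω es ∘S τ e

IsEdgeOrdering : ∀ {n} → SignedGraph n → List (Edge n) → Set
IsEdgeOrdering G ω = ω ↭ edges G

HasOddFullCyclicOrdering : ∀ {n} → SignedGraph n → Set
HasOddFullCyclicOrdering G =
  ∃ λ ω → IsEdgeOrdering G ω × OddFullCyclic (πω ω)

module _ {n : ℕ} (es : List (Fin n × Fin n)) where

  Joins : Fin (length es) → Fin n → Fin n → Set
  Joins e a b = lookup es e ≡ (a , b) ⊎ lookup es e ≡ (b , a)

  data Walk : Fin n → Fin n → Set where
    here : ∀ {u} → Walk u u
    step : ∀ {u w v} (e : Fin (length es)) → Joins e u w → Walk w v → Walk u v

  Connected : Set
  Connected = (u v : Fin n) → Walk u v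

  -- a cycle of length m ≥ 1: distinct vertices v_0,…,v_{m-1} and distinct
  -- edges f_0,…,f_{m-1} with f_k joining v_k and v_{k+1 mod m}
  -- (for a multigraph, two parallel edges form a cycle of length 2)
  Cycle : Set
  Cycle = Σ ℕ λ m → 1 ≤ m ×
          Σ (Fin m → Fin n) λ v → Σ (Fin m → Fin (length es)) λ f →
            Injective _≡_ _≡_ v × Injective _≡_ _≡_ f ×
            ((k : Fin m) → Joins (f k) (v k) (v (next k)))

  IsTree : Set
  IsTree = Connected × ¬ Cycle

-- The sign bits of a signed permutation, xor-ed over [n], form a ℤ/2-valued parity that is
-- additive under composition; each generator τ_e contributes 1 exactly when e is a loop, and
-- an odd full cycle has parity 1. Hence G has a loop. Each x is joined to π_ω(x) by a walk in Ḡ,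
-- and π_ω cycles through all vertices, so Ḡ is connected and has at least n − 1 edges
-- (contract an edge and induct). With |E_G| = n this leaves exactly one loop and n − 1 edges
-- in Ḡ, and Ḡ has no cycle: deleting a cycle edge would leave a connected graph with n − 2 edges.

module Submission where

open import Defs
open import Data.Nat using (ℕ; zero; suc; _+_; _≤_; _<_; z≤n; s≤s; s≤s⁻¹; NonZero)
open import Data.Nat.Properties
  using (≤-trans; <-irrefl; +-comm; +-assoc; +-monoʳ-≤; n<1+n; n>0⇒n≢0; suc-injective; ≤-reflexive; module ≤-Reasoning)
open import Data.Nat.DivMod using (_%_; _mod_; %-distribˡ-+; m%n%n≡m%n; m<n⇒m%n≡m; n%n≡0)
open import Data.Fin using (Fin; zero; suc; toℕ; punchIn; punchOut)
open import Data.Fin.Properties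
  using (_≟_; toℕ-fromℕ<; toℕ-injective; toℕ<n; punchOut-cong; punchOut-punchIn; punchInᵢ≢i)
import Data.Fin.Properties as Fin
open import Data.Fin.Permutation using (transpose) renaming (id to idₚ)
import Data.Fin.Permutation.Components as PC
open import Data.Fin.Subset using (Subset; _∈_; _⊂_; ∣_∣)
open import Data.Fin.Subset.Properties using (p⊂q⇒∣p∣<∣q∣; ∣p∣≤n)
open import Data.Bool using (Bool; true; false; _xor_)
open import Data.Bool.Properties using (xor-∧-commutativeRing)
open import Data.Vec using (tabulate)
open import Data.Vec.Properties using (lookup∘tabulate; lookup⇒[]=; []=⇒lookup)
open import Data.List using (List; []; _∷_; map; foldr; allFin; length; lookup; _++_)
import Data.List as List
open import Data.List.Properties using (map-tabulate; length-++; length-map)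
open import Data.List.Membership.Propositional using () renaming (_∈_ to _∈ₗ_)
open import Data.List.Membership.Propositional.Properties using (∈-length; ∈-map⁻; ∈-++⁺ˡ; ∈-++⁺ʳ; ∈-++⁻; ∈-lookup)
open import Data.List.Relation.Unary.Any using (here; there; index)
open import Data.List.Relation.Unary.Any.Properties using (lookup-index)
open import Data.List.Relation.Unary.All using (All; []; _∷_) renaming (lookup to All-lookup; tabulate to All-tabulate)
open import Data.List.Relation.Unary.All.Properties using (++⁺)
open import Data.List.Relation.Binary.Permutation.Propositional.Properties using (∈-resp-↭)
open import Data.Product using (_×_; _,_; proj₁; proj₂; Σ; ∃)
import Data.Product as Prod
open import Data.Sum using (_⊎_; inj₁; inj₂)
open import Data.Unit using (⊤)
open import Relation.Binary.PropositionalEquality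
open import Relation.Nullary using (¬_; does; yes; no; ¬?; contradiction)
open import Relation.Nullary.Decidable using (dec-true)
open import Relation.Unary using (Pred; Decidable)
open import Function using (_∘_; id)
open import Function.Bundles using (_↔_; Inverse)
open import Function.Definitions using (Injective)
open import Algebra.Bundles using (CommutativeRing)
open import Level using (Level)

open CommutativeRing xor-∧-commutativeRing using (+-commutativeMonoid)
open import Algebra.Properties.CommutativeMonoid.Sum +-commutativeMonoid
  using (sum; sum-permute; ∑-distrib-+; sum-cong-≗; sum-replicate-zero)

private
  variable
    n n′ m k K : ℕ
    ℓ : Level

signParity : SPerm n → Bool
signParity η = sum (proj₁ ∘ η)

foldr-xor-allFin : (f : Fin n → Bool) → foldr _xor_ false (map f (allFin n)) ≡ sum f
foldr-xor-allFin {n} f = trans (cong (foldr _xor_ false) (map-tabulate id f)) (go n f)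
  where
  go : ∀ n (f : Fin n → Bool) → foldr _xor_ false (List.tabulate f) ≡ sum f
  go zero    f = refl
  go (suc n) f = cong (f zero xor_) (go n (f ∘ suc))

sum-reindex : (f : Fin n → Bool) (p : Fin n ↔ Fin n) → sum (f ∘ Inverse.to p) ≡ sum f
sum-reindex f p = sym (sum-permute f p)

sum-indicator : (i : Fin n) → sum (λ x → does (x ≟ i)) ≡ true
sum-indicator {suc n} zero    = cong (true xor_) (sum-replicate-zero n)
sum-indicator {suc n} (suc i) = sum-indicator i

∘S-unfold : (η θ : SPerm n) (x : Fin n) →
            (η ∘S θ) x ≡ (proj₁ (θ x) xor proj₁ (η (proj₂ (θ x))) , proj₂ (η (proj₂ (θ x))))
∘S-unfold η θ x with θ x
... | s , j with η j
...   | t , k = refl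

signParity-∘S : (η θ : SPerm n) (p : Fin n ↔ Fin n) → (∀ x → proj₂ (θ x) ≡ Inverse.to p x) →
                signParity (η ∘S θ) ≡ signParity θ xor signParity η
signParity-∘S η θ p θ≗p = begin
  signParity (η ∘S θ)
    ≡⟨ sum-cong-≗ (cong proj₁ ∘ ∘S-unfold η θ) ⟩
  sum (λ x → proj₁ (θ x) xor proj₁ (η (proj₂ (θ x))))
    ≡⟨ ∑-distrib-+ (proj₁ ∘ θ) _ ⟩
  signParity θ xor sum (λ x → proj₁ (η (proj₂ (θ x))))
    ≡⟨ cong (signParity θ xor_) (sum-cong-≗ (cong (proj₁ ∘ η) ∘ θ≗p)) ⟩
  signParity θ xor sum (proj₁ ∘ η ∘ Inverse.to p)
    ≡⟨ cong (signParity θ xor_) (sum-reindex (proj₁ ∘ η) p) ⟩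
  signParity θ xor signParity η ∎
  where open ≡-Reasoning

signParity-oddFullCyclic : (η : SPerm n) → OddFullCyclic η → signParity η ≡ true
signParity-oddFullCyclic η (ord , ε , η-cycle , ε-odd) = begin
  signParity η                          ≡⟨ sum-reindex (proj₁ ∘ η) ord ⟨
  sum (proj₁ ∘ η ∘ Inverse.to ord)      ≡⟨ sum-cong-≗ (cong proj₁ ∘ η-cycle) ⟩
  sum ε                                 ≡⟨ foldr-xor-allFin ε ⟨
  foldr _xor_ false (map ε (allFin _))  ≡⟨ ε-odd ⟩
  true                                  ∎
  where open ≡-Reasoning

underlying : Edge n → Fin n ↔ Fin n
underlying (pos i j) = transpose i j
underlying (neg i j) = transpose i j
underlying (loop i)  = idₚ

τ-vertex : (e : Edge n) (x : Fin n) → proj₂ (τ e x) ≡ Inverse.to (underlying e) x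
τ-vertex (pos i j) x with does (x ≟ i)
... | true  = refl
... | false with does (x ≟ j)
...   | true  = refl
...   | false = refl
τ-vertex (neg i j) x with does (x ≟ i)
... | true  = refl
... | false with does (x ≟ j)
...   | true  = refl
...   | false = refl
τ-vertex (loop i) x with x ≟ i
... | yes refl = refl
... | no _     = refl

isLoop : Edge n → Bool
isLoop (loop _) = true
isLoop _        = false

WellFormed : Edge n → Set
WellFormed (neg i j) = i ≢ j
WellFormed _         = ⊤

τ-sign-pos : (i j x : Fin n) → proj₁ (τ (pos i j) x) ≡ false
τ-sign-pos i j x with does (x ≟ i)
... | true  = refl
... | false with does (x ≟ j)
...   | true  = refl
...   | false = refl

τ-sign-neg : (i j x : Fin n) → i ≢ j → proj₁ (τ (neg i j) x) ≡ does (x ≟ i) xor does (x ≟ j)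
τ-sign-neg i j x i≢j with x ≟ i | x ≟ j
... | yes refl | yes refl = contradiction refl i≢j
... | yes refl | no _     = refl
... | no _     | yes _    = refl
... | no _     | no _     = refl

τ-sign-loop : (i x : Fin n) → proj₁ (τ (loop i) x) ≡ does (x ≟ i)
τ-sign-loop i x with does (x ≟ i)
... | true  = refl
... | false = refl

signParity-τ : (e : Edge n) → WellFormed e → signParity (τ e) ≡ isLoop e
signParity-τ {n} (pos i j) _ = trans (sum-cong-≗ (τ-sign-pos i j)) (sum-replicate-zero n)
signParity-τ (neg i j) i≢j = begin
  sum (λ x → proj₁ (τ (neg i j) x))           ≡⟨ sum-cong-≗ (λ x → τ-sign-neg i j x i≢j) ⟩
  sum (λ x → does (x ≟ i) xor does (x ≟ j))   ≡⟨ ∑-distrib-+ (λ x → does (x ≟ i)) _ ⟩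
  sum (λ x → does (x ≟ i)) xor sum (λ x → does (x ≟ j))
                                              ≡⟨ cong₂ _xor_ (sum-indicator i) (sum-indicator j) ⟩
  false                                       ∎
  where open ≡-Reasoning
signParity-τ (loop i) _ = trans (sum-cong-≗ (τ-sign-loop i)) (sum-indicator i)

loopParity : List (Edge n) → Bool
loopParity ω = foldr _xor_ false (map isLoop ω)

signParity-πω : (ω : List (Edge n)) → All WellFormed ω → signParity (πω ω) ≡ loopParity ω
signParity-πω {n} [] [] = sum-replicate-zero n
signParity-πω (e ∷ ω) (e-wf ∷ ω-wf) = begin
  signParity (πω ω ∘S τ e)               ≡⟨ signParity-∘S (πω ω) (τ e) (underlying e) (τ-vertex e) ⟩
  signParity (τ e) xor signParity (πω ω) ≡⟨ cong₂ _xor_ (signParity-τ e e-wf) (signParity-πω ω ω-wf) ⟩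
  isLoop e xor loopParity ω              ∎
  where open ≡-Reasoning

loopParity-loopFree : (ω : List (Edge n)) → All (λ e → isLoop e ≡ false) ω → loopParity ω ≡ false
loopParity-loopFree []      []             = refl
loopParity-loopFree (e ∷ ω) (e-nl ∷ ω-nl) = cong₂ _xor_ e-nl (loopParity-loopFree ω ω-nl)

-- Multigraphs given by an edge function Fin m → Fin n × Fin n; unlike an edge list,
-- it can be contracted or have an edge deleted without reindexing the edges.

data Joinsᶠ (E : Fin m → Fin n × Fin n) (e : Fin m) (a b : Fin n) : Set where
  forward  : E e ≡ (a , b) → Joinsᶠ E e a b
  backward : E e ≡ (b , a) → Joinsᶠ E e a b

data Walkᶠ (E : Fin m → Fin n × Fin n) : Fin n → Fin n → Set where
  here : ∀ {u} → Walkᶠ E u u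
  step : ∀ {u w v} (e : Fin m) → Joinsᶠ E e u w → Walkᶠ E w v → Walkᶠ E u v

Connectedᶠ : (Fin m → Fin n × Fin n) → Set
Connectedᶠ E = ∀ u v → Walkᶠ E u v

module _ {E : Fin m → Fin n × Fin n} where

  _++ʷ_ : ∀ {u v w} → Walkᶠ E u v → Walkᶠ E v w → Walkᶠ E u w
  here         ++ʷ q = q
  step e j p   ++ʷ q = step e j (p ++ʷ q)

  edgeʷ : ∀ {e a b} → Joinsᶠ E e a b → Walkᶠ E a b
  edgeʷ {e} j = step e j here

  Joinsᶠ-sym : ∀ {e a b} → Joinsᶠ E e a b → Joinsᶠ E e b a
  Joinsᶠ-sym (forward p)  = backward p
  Joinsᶠ-sym (backward p) = forward p

  reverseʷ : ∀ {u v} → Walkᶠ E u v → Walkᶠ E v u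
  reverseʷ here         = here
  reverseʷ (step e j p) = reverseʷ p ++ʷ edgeʷ (Joinsᶠ-sym j)

  Joinsᶠ-ends : ∀ {e a b u w} → Joinsᶠ E e a b → Joinsᶠ E e u w →
                (u ≡ a × w ≡ b) ⊎ (u ≡ b × w ≡ a)
  Joinsᶠ-ends (forward p)  (forward q)  with trans (sym q) p
  ... | refl = inj₁ (refl , refl)
  Joinsᶠ-ends (forward p)  (backward q) with trans (sym q) p
  ... | refl = inj₂ (refl , refl)
  Joinsᶠ-ends (backward p) (forward q)  with trans (sym q) p
  ... | refl = inj₂ (refl , refl)
  Joinsᶠ-ends (backward p) (backward q) with trans (sym q) p
  ... | refl = inj₁ (refl , refl)

  walkAlong : (w : ℕ → Fin n) (d : ℕ) → (∀ i → i < d → Walkᶠ E (w i) (w (suc i))) → Walkᶠ E (w 0) (w d)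
  walkAlong w zero    steps = here
  walkAlong w (suc d) steps =
    steps 0 (s≤s z≤n) ++ʷ walkAlong (w ∘ suc) d (λ i i<d → steps (suc i) (s≤s i<d))

simulateʷ : {E : Fin m → Fin n × Fin n} {E′ : Fin k → Fin n′ × Fin n′} (c : Fin n → Fin n′) →
            (∀ {e a b} → Joinsᶠ E e a b → Walkᶠ E′ (c a) (c b)) →
            ∀ {u v} → Walkᶠ E u v → Walkᶠ E′ (c u) (c v)
simulateʷ c sim here         = here
simulateʷ c sim (step e j p) = sim j ++ʷ simulateʷ c sim p

fromJoins : (es : List (Fin n × Fin n)) → ∀ {e a b} → Joins es e a b → Joinsᶠ (lookup es) e a b
fromJoins es (inj₁ p) = forward p
fromJoins es (inj₂ p) = backward p

toWalk : {es : List (Fin n × Fin n)} → ∀ {u v} → Walkᶠ (lookup es) u v → Walk es u v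
toWalk here                    = here
toWalk (step e (forward p) w)  = step e (inj₁ p) (toWalk w)
toWalk (step e (backward p) w) = step e (inj₂ p) (toWalk w)

-- Proper edges: contraction creates self-loops, so only edges with distinct ends are counted

toSubset : {P : Pred (Fin m) ℓ} → Decidable P → Subset m
toSubset P? = tabulate (does ∘ P?)

module _ {P : Pred (Fin m) ℓ} (P? : Decidable P) where

  ∈-toSubset⁺ : ∀ {x} → P x → x ∈ toSubset P?
  ∈-toSubset⁺ {x} px = lookup⇒[]= x _ (trans (lookup∘tabulate _ x) (dec-true (P? x) px))

  ∈-toSubset⁻ : ∀ {x} → x ∈ toSubset P? → P x
  ∈-toSubset⁻ {x} x∈ with P? x | trans (sym (lookup∘tabulate _ x)) ([]=⇒lookup x∈)
  ... | yes px | _ = px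

toSubset-⊂ : {P Q : Pred (Fin m) ℓ} (P? : Decidable P) (Q? : Decidable Q) →
             (∀ {x} → P x → Q x) → (x : Fin m) → Q x → ¬ P x → toSubset P? ⊂ toSubset Q?
toSubset-⊂ P? Q? P⇒Q x qx ¬px =
  ∈-toSubset⁺ Q? ∘ P⇒Q ∘ ∈-toSubset⁻ P? , x , ∈-toSubset⁺ Q? qx , ¬px ∘ ∈-toSubset⁻ P?

IsProper : Fin n × Fin n → Set
IsProper (a , b) = a ≢ b

proper? : Decidable {A = Fin n × Fin n} IsProper
proper? (a , b) = ¬? (a ≟ b)

properEdges : (Fin m → Fin n × Fin n) → Subset m
properEdges E = toSubset (proper? ∘ E)

∣properEdges∣-< : (E : Fin m → Fin n × Fin n) (E′ : Fin m → Fin n′ × Fin n′) →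
                  (∀ e → IsProper (E′ e) → IsProper (E e)) →
                  (e : Fin m) → IsProper (E e) → ¬ IsProper (E′ e) →
                  ∣ properEdges E′ ∣ < ∣ properEdges E ∣
∣properEdges∣-< E E′ E′⇒E e e-proper e-improper =
  p⊂q⇒∣p∣<∣q∣ (toSubset-⊂ (proper? ∘ E′) (proper? ∘ E) (E′⇒E _) e e-proper e-improper)

Joinsᶠ-proper : {E : Fin m → Fin n × Fin n} → ∀ {e a b} → Joinsᶠ E e a b → a ≢ b → IsProper (E e)
Joinsᶠ-proper (forward p)  a≢b rewrite p = a≢b
Joinsᶠ-proper (backward p) a≢b rewrite p = a≢b ∘ sym

selfLoop-improper : {E : Fin m → Fin n × Fin n} → ∀ {e a} → Joinsᶠ E e a a → ¬ IsProper (E e)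
selfLoop-improper (forward p)  proper = subst IsProper p proper refl
selfLoop-improper (backward p) proper = subst IsProper p proper refl

walk⇒properEdge : {E : Fin m → Fin n × Fin n} → ∀ {u v} → Walkᶠ E u v → u ≢ v → ∃ λ e → IsProper (E e)
walk⇒properEdge here u≢v = contradiction refl u≢v
walk⇒properEdge {E = E} {u = u} (step {w = w} e j p) u≢v with u ≟ w
... | yes refl = walk⇒properEdge p u≢v
... | no u≢w   = e , Joinsᶠ-proper {E = E} j u≢w

module Contraction {a b : Fin (suc k)} (b≢a : b ≢ a) where

  contract : Fin (suc k) → Fin k
  contract x with b ≟ x
  ... | yes _   = punchOut b≢a
  ... | no  b≢x = punchOut b≢x

  contract-merges : contract a ≡ contract b
  contract-merges with b ≟ a | b ≟ b
  ... | yes b≡a | _       = contradiction b≡a b≢a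
  ... | no  _   | yes _   = punchOut-cong b refl
  ... | no  _   | no  b≢b = contradiction refl b≢b

  contract-punchIn : (u : Fin k) → contract (punchIn b u) ≡ u
  contract-punchIn u with b ≟ punchIn b u
  ... | yes b≡ = contradiction (sym b≡) (punchInᵢ≢i b u)
  ... | no  _  = trans (punchOut-cong b refl) (punchOut-punchIn b)

contractEdge : (E : Fin m → Fin (suc k) × Fin (suc k)) → Connectedᶠ E → (e : Fin m) → IsProper (E e) →
               Σ (Fin m → Fin k × Fin k) λ E′ → Connectedᶠ E′ × ∣ properEdges E′ ∣ < ∣ properEdges E ∣
contractEdge {m = m} {k = k} E conn e e-proper =
  E′ , E′-connected , ∣properEdges∣-< E E′ E′⇒E e e-proper (λ merged → merged contract-merges)
  where
  open Contraction (e-proper ∘ sym)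
  E′ : Fin m → Fin k × Fin k
  E′ = Prod.map contract contract ∘ E
  E′-connected : Connectedᶠ E′
  E′-connected u v = subst₂ (Walkᶠ E′) (contract-punchIn u) (contract-punchIn v)
    (simulateʷ contract (λ { (forward p)  → edgeʷ (forward (cong (Prod.map contract contract) p))
                           ; (backward p) → edgeʷ (backward (cong (Prod.map contract contract) p)) })
               (conn (punchIn _ u) (punchIn _ v)))
  E′⇒E : ∀ e → IsProper (E′ e) → IsProper (E e)
  E′⇒E e E′e-proper ends≡ = E′e-proper (cong contract ends≡)

connected⇒≤1+∣properEdges∣ : (E : Fin m → Fin n × Fin n) → Connectedᶠ E → n ≤ suc ∣ properEdges E ∣
connected⇒≤1+∣properEdges∣ {n = zero}        E conn = z≤n
connected⇒≤1+∣properEdges∣ {n = suc zero}    E conn = s≤s z≤n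
connected⇒≤1+∣properEdges∣ {n = suc (suc n)} E conn =
  let e , e-proper             = walk⇒properEdge {E = E} (conn zero (suc zero)) (λ ())
      E′ , E′-connected , fewer = contractEdge E conn e e-proper
  in ≤-trans (s≤s (connected⇒≤1+∣properEdges∣ {n = suc n} E′ E′-connected)) (s≤s fewer)

toℕ-mod : ∀ j d .{{_ : NonZero d}} → toℕ (j mod d) ≡ j % d
toℕ-mod j d = toℕ-fromℕ< _

next-mod : ∀ K j → next {suc K} (j mod suc K) ≡ suc j mod suc K
next-mod K j = toℕ-injective (begin
  toℕ (suc (toℕ (j mod d)) mod d) ≡⟨ toℕ-mod (suc (toℕ (j mod d))) d ⟩
  suc (toℕ (j mod d)) % d         ≡⟨ cong (λ r → suc r % d) (toℕ-mod j d) ⟩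
  (1 + j % d) % d                 ≡⟨ %-distribˡ-+ 1 (j % d) d ⟩
  (1 % d + j % d % d) % d         ≡⟨ cong (λ r → (1 % d + r) % d) (m%n%n≡m%n j d) ⟩
  (1 % d + j % d) % d             ≡⟨ %-distribˡ-+ 1 j d ⟨
  suc j % d                       ≡⟨ toℕ-mod (suc j) d ⟨
  toℕ (suc j mod d)               ∎)
  where
  open ≡-Reasoning
  d = suc K

toℕ-mod-self : (k : Fin (suc K)) → toℕ k mod suc K ≡ k
toℕ-mod-self k = toℕ-injective (trans (toℕ-mod (toℕ k) _) (m<n⇒m%n≡m (toℕ<n k)))

module CycleEdgeDeletion (E : Fin m → Fin n × Fin n)
  (v : Fin (suc (suc K)) → Fin n) (f : Fin (suc (suc K)) → Fin m)
  (v-injective : Injective _≡_ _≡_ v) (f-injective : Injective _≡_ _≡_ f)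
  (cycle : ∀ k → Joinsᶠ E (f k) (v k) (v (next k))) where

  -- the deleted edge is kept as a self-loop at v 0, which no longer counts
  E′ : Fin m → Fin n × Fin n
  E′ e with e ≟ f zero
  ... | yes _ = v zero , v zero
  ... | no  _ = E e

  E′-kept : ∀ {e} → e ≢ f zero → E′ e ≡ E e
  E′-kept {e} e≢f₀ with e ≟ f zero
  ... | yes e≡f₀ = contradiction e≡f₀ e≢f₀
  ... | no  _    = refl

  Joinsᶠ-kept : ∀ {e a b} → e ≢ f zero → Joinsᶠ E e a b → Joinsᶠ E′ e a b
  Joinsᶠ-kept e≢f₀ (forward p)  = forward (trans (E′-kept e≢f₀) p)
  Joinsᶠ-kept e≢f₀ (backward p) = backward (trans (E′-kept e≢f₀) p)

  around : ∀ i → i < suc K → Walkᶠ E′ (v (suc i mod suc (suc K))) (v (suc (suc i) mod suc (suc K)))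
  around i i<K+1 = edgeʷ (Joinsᶠ-kept later
    (subst (λ r → Joinsᶠ E (f i′) (v i′) (v r)) (next-mod (suc K) (suc i)) (cycle i′)))
    where
    i′ : Fin (suc (suc K))
    i′ = suc i mod suc (suc K)
    later : f i′ ≢ f zero
    later f-eq with trans (sym (m<n⇒m%n≡m (s≤s i<K+1)))
                          (trans (sym (toℕ-mod (suc i) _)) (cong toℕ (f-injective f-eq)))
    ... | ()

  bypass : Walkᶠ E′ (v (suc zero)) (v zero)
  bypass = subst (Walkᶠ E′ _) (cong v (toℕ-injective (trans (toℕ-mod (suc (suc K)) _) (n%n≡0 (2 + K)))))
                 (walkAlong (λ i → v (suc i mod suc (suc K))) (suc K) around)

  E′-connected : Connectedᶠ E → Connectedᶠ E′
  E′-connected conn u w = simulateʷ id bridge (conn u w)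
    where
    bridge : ∀ {e a b} → Joinsᶠ E e a b → Walkᶠ E′ a b
    bridge {e} j with e ≟ f zero
    ... | no  e≢f₀ = edgeʷ (Joinsᶠ-kept e≢f₀ j)
    ... | yes refl with Joinsᶠ-ends (cycle zero) j
    ...   | inj₁ (refl , refl) = reverseʷ bypass
    ...   | inj₂ (refl , refl) = bypass

  fewer : ∣ properEdges E′ ∣ < ∣ properEdges E ∣
  fewer = ∣properEdges∣-< E E′ E′⇒E (f zero) (Joinsᶠ-proper {E = E} (cycle zero) v₀≢v₁)
                          deleted-improper
    where
    E′⇒E : ∀ e → IsProper (E′ e) → IsProper (E e)
    E′⇒E e E′e-proper with e ≟ f zero
    ... | yes _ = contradiction refl E′e-proper
    ... | no  _ = E′e-proper
    v₀≢v₁ : v zero ≢ v (suc zero)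
    v₀≢v₁ v-eq with v-injective v-eq
    ... | ()
    deleted-improper : ¬ IsProper (E′ (f zero))
    deleted-improper with f zero ≟ f zero
    ... | yes _   = λ proper → proper refl
    ... | no  f₀≢ = contradiction refl f₀≢

connected×cycle⇒≤∣properEdges∣ : (E : Fin m → Fin n × Fin n) → Connectedᶠ E →
  (v : Fin (suc (suc K)) → Fin n) (f : Fin (suc (suc K)) → Fin m) →
  Injective _≡_ _≡_ v → Injective _≡_ _≡_ f → (∀ k → Joinsᶠ E (f k) (v k) (v (next k))) →
  n ≤ ∣ properEdges E ∣
connected×cycle⇒≤∣properEdges∣ E conn v f v-inj f-inj cycle =
  ≤-trans (connected⇒≤1+∣properEdges∣ E′ (E′-connected conn)) fewer
  where open CycleEdgeDeletion E v f v-inj f-inj cycle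

cyclicOrder⇒connected : (E : Fin m → Fin n × Fin n) (ord : Fin n ↔ Fin n) →
  (∀ k → Walkᶠ E (Inverse.to ord k) (Inverse.to ord (next k))) → Connectedᶠ E
cyclicOrder⇒connected {n = zero}  E ord steps ()
cyclicOrder⇒connected {n = suc n} E ord steps u w = reverseʷ (fromFirst u) ++ʷ fromFirst w
  where
  open Inverse ord using (to; from; strictlyInverseˡ)
  fromFirst : ∀ u → Walkᶠ E (to zero) u
  fromFirst u = subst (Walkᶠ E _) (trans (cong to (toℕ-mod-self (from u))) (strictlyInverseˡ u))
    (walkAlong (λ j → to (j mod suc n)) (toℕ (from u))
      (λ j _ → subst (λ r → Walkᶠ E (to (j mod suc n)) (to r)) (next-mod n j) (steps (j mod suc n))))

module _ (G : SignedGraph n) where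

  Ḡ : Fin (length (barEdges G)) → Fin n × Fin n
  Ḡ = lookup (barEdges G)

  data EdgeOf : Edge n → Set where
    posEdge  : ∀ {i j} → (i , j) ∈ₗ E⁺ G → EdgeOf (pos i j)
    negEdge  : ∀ {i j} → (i , j) ∈ₗ E⁻ G → EdgeOf (neg i j)
    loopEdge : ∀ {i}   → i ∈ₗ L G       → EdgeOf (loop i)

  edgeOf : ∀ {e} → e ∈ₗ edges G → EdgeOf e
  edgeOf e∈ with ∈-++⁻ (map (λ p → pos (proj₁ p) (proj₂ p)) (E⁺ G)) e∈
  ... | inj₁ e∈⁺ with ∈-map⁻ (λ p → pos (proj₁ p) (proj₂ p)) e∈⁺
  ...   | _ , p∈ , refl = posEdge p∈
  edgeOf e∈ | inj₂ e∈⁻L with ∈-++⁻ (map (λ p → neg (proj₁ p) (proj₂ p)) (E⁻ G)) e∈⁻L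
  ... | inj₁ e∈⁻ with ∈-map⁻ (λ p → neg (proj₁ p) (proj₂ p)) e∈⁻
  ...   | _ , p∈ , refl = negEdge p∈
  edgeOf e∈ | inj₂ _ | inj₂ e∈L with ∈-map⁻ loop e∈L
  ...   | _ , i∈ , refl = loopEdge i∈

  edgeOf-wellFormed : ∀ {e} → EdgeOf e → WellFormed e
  edgeOf-wellFormed (posEdge _)  = _
  edgeOf-wellFormed (negEdge p∈) = Fin.<⇒≢ (All-lookup (E⁻-canonical G) p∈)
  edgeOf-wellFormed (loopEdge _) = _

  Ḡ-proper : ∀ e → IsProper (Ḡ e)
  Ḡ-proper e = Fin.<⇒≢ (All-lookup (++⁺ (E⁺-canonical G) (E⁻-canonical G)) (∈-lookup e))

  transpose-walk : ∀ {i j} → (i , j) ∈ₗ barEdges G → ∀ x → Walkᶠ Ḡ x (PC.transpose i j x)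
  transpose-walk {i} {j} p∈ x with x ≟ i
  ... | yes refl = edgeʷ {e = index p∈} (forward (sym (lookup-index p∈)))
  ... | no _ with x ≟ j
  ...   | yes refl = edgeʷ {e = index p∈} (backward (sym (lookup-index p∈)))
  ...   | no _     = here

  τ-walk : ∀ {e} → EdgeOf e → ∀ x → Walkᶠ Ḡ x (proj₂ (τ e x))
  τ-walk {e} e-of x = subst (Walkᶠ Ḡ x) (sym (τ-vertex e x)) (underlying-walk e-of)
    where
    underlying-walk : ∀ {e} → EdgeOf e → Walkᶠ Ḡ x (Inverse.to (underlying e) x)
    underlying-walk (posEdge p∈)  = transpose-walk (∈-++⁺ˡ p∈) x
    underlying-walk (negEdge p∈)  = transpose-walk (∈-++⁺ʳ (E⁺ G) p∈) x
    underlying-walk (loopEdge _)  = here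

  πω-walk : (ω : List (Edge n)) → (∀ {e} → e ∈ₗ ω → EdgeOf e) → ∀ x → Walkᶠ Ḡ x (proj₂ (πω ω x))
  πω-walk []      _     x = here
  πω-walk (e ∷ ω) ω⊆G x = subst (Walkᶠ Ḡ x) (sym (cong proj₂ (∘S-unfold (πω ω) (τ e) x)))
    (τ-walk (ω⊆G (here refl)) x ++ʷ πω-walk ω (ω⊆G ∘ there) _)

  length-edges : length (edges G) ≡ length (barEdges G) + length (L G)
  length-edges = begin
    length (edges G)
      ≡⟨ length-++ (map _ (E⁺ G)) ⟩
    length (map _ (E⁺ G)) + length (map _ (E⁻ G) ++ map loop (L G))
      ≡⟨ cong (length (map _ (E⁺ G)) +_) (length-++ (map _ (E⁻ G))) ⟩
    length (map _ (E⁺ G)) + (length (map _ (E⁻ G)) + length (map loop (L G)))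
      ≡⟨ cong₂ _+_ (length-map _ (E⁺ G)) (cong₂ _+_ (length-map _ (E⁻ G)) (length-map loop (L G))) ⟩
    length (E⁺ G) + (length (E⁻ G) + length (L G))
      ≡⟨ +-assoc (length (E⁺ G)) _ _ ⟨
    length (E⁺ G) + length (E⁻ G) + length (L G)
      ≡⟨ cong (_+ length (L G)) (length-++ (E⁺ G)) ⟨
    length (barEdges G) + length (L G)
      ∎
    where open ≡-Reasoning

  module _ {ω : List (Edge n)} (ω-ordering : IsEdgeOrdering G ω) (odd : OddFullCyclic (πω ω)) where

    private
      ω-edgeOf : ∀ {e} → e ∈ₗ ω → EdgeOf e
      ω-edgeOf = edgeOf ∘ ∈-resp-↭ ω-ordering

    Ḡ-connected : Connectedᶠ Ḡ
    Ḡ-connected =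
      let ord , _ , π-cycle , _ = odd
      in cyclicOrder⇒connected Ḡ ord
           (λ k → subst (Walkᶠ Ḡ _) (cong proj₂ (π-cycle k)) (πω-walk ω ω-edgeOf _))

    hasLoop : length (L G) ≢ 0
    hasLoop |L|≡0 = contradiction parity λ ()
      where
      notLoop : ∀ {e} → EdgeOf e → isLoop e ≡ false
      notLoop (posEdge _)   = refl
      notLoop (negEdge _)   = refl
      notLoop (loopEdge i∈) = contradiction |L|≡0 (n>0⇒n≢0 (∈-length i∈))
      parity : true ≡ false
      parity = begin
        true               ≡⟨ signParity-oddFullCyclic (πω ω) odd ⟨
        signParity (πω ω)  ≡⟨ signParity-πω ω (All-tabulate (edgeOf-wellFormed ∘ ω-edgeOf)) ⟩
        loopParity ω       ≡⟨ loopParity-loopFree ω (All-tabulate (notLoop ∘ ω-edgeOf)) ⟩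
        false              ∎
        where open ≡-Reasoning

oneLoop : ∀ s l → s + l ≡ suc n → n ≤ s → l ≢ 0 → l ≡ 1 × s ≡ n
oneLoop s zero          _  _   l≢0 = contradiction refl l≢0
oneLoop s (suc zero)    eq _   _   = refl , suc-injective (trans (+-comm 1 s) eq)
oneLoop {n} s (suc (suc l)) eq n≤s _ = contradiction (begin-strict
  suc n           <⟨ n<1+n (suc n) ⟩
  suc (suc n)     ≤⟨ s≤s (s≤s n≤s) ⟩
  2 + s           ≡⟨ +-comm 2 s ⟩
  s + 2           ≤⟨ +-monoʳ-≤ s (s≤s (s≤s z≤n)) ⟩
  s + suc (suc l) ≡⟨ eq ⟩
  suc n           ∎) (<-irrefl refl)
  where open ≤-Reasoning

corollary2p7 : (n : ℕ) (G : SignedGraph n) →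
    HasOddFullCyclicOrdering G → length (edges G) ≡ n →
    IsTree (barEdges G) × length (L G) ≡ 1
corollary2p7 zero G (ω , _ , odd) _ with signParity-oddFullCyclic (πω ω) odd
... | ()
corollary2p7 (suc n) G (ω , ω-ordering , odd) |E|≡n =
  ((λ u v → toWalk (connected u v)) , acyclic) , proj₁ counts
  where
  connected : Connectedᶠ (Ḡ G)
  connected = Ḡ-connected G ω-ordering odd
  proper≤bar : ∣ properEdges (Ḡ G) ∣ ≤ length (barEdges G)
  proper≤bar = ∣p∣≤n (properEdges (Ḡ G))
  counts : length (L G) ≡ 1 × length (barEdges G) ≡ n
  counts = oneLoop _ _ (trans (sym (length-edges G)) |E|≡n)
    (≤-trans (s≤s⁻¹ (connected⇒≤1+∣properEdges∣ (Ḡ G) connected)) proper≤bar)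
    (hasLoop G ω-ordering odd)
  acyclic : ¬ Cycle (barEdges G)
  acyclic (zero , () , _)
  acyclic (suc zero , _ , v , f , _ , _ , joins) =
    selfLoop-improper (fromJoins (barEdges G) (joins zero)) (Ḡ-proper G (f zero))
  acyclic (suc (suc K) , _ , v , f , v-inj , f-inj , joins) = <-irrefl refl (begin
    suc n                           ≤⟨ connected×cycle⇒≤∣properEdges∣ (Ḡ G) connected v f v-inj f-inj
                                         (fromJoins (barEdges G) ∘ joins) ⟩
    ∣ properEdges (Ḡ G) ∣           ≤⟨ proper≤bar ⟩
    length (barEdges G)             ≡⟨ proj₂ counts ⟩
    n                               ∎)
    where open ≤-Reasoning
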